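{- Let $p$ be an integer with $p \equiv 1$ or $p\equiv 5 \pmod 6$. Then every vertex-transitive map with Schläfli type $\{p,3\}$ is either regular or chiral.
   Context: A map is a 2-cell embedding of a finite multigraph on a closed surface without boundary; faces are the components of the complement of the graph. Flags are the triangles of the induced triangulation with vertices a vertex, the midpoint of an incident edge and the centre of a face incident to that edge; two flags are $i$-adjacent ($i=0,1,2$) if they differ only in the vertex, respectively edge-midpoint, respectively face-centre (i.e. share the segment between the other two points). An automorphism is a graph automorphism extending to a homeomorphism of the surface; $\Gamma(M)$ is the automorphism group. $M$ is vertex-transitive if $\Gamma(M)$ is transitive on vertices. $M$ has Schläfli type $\{p,q\}$ if every face has $p$ edges and every vertex has degree $q$. $M$ is regular if $\Gamma(M)$ is transitive on flags, and chiral if $\Gamma(M)$ has exactly two orbits on flags and any two adjacent flags lie in distinct orbits. -}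

module Defs where

open import Data.Nat using (ℕ; zero; suc; _<_; _≤_; _%_)
open import Data.Fin using (Fin)
open import Data.Product using (Σ; _×_; ∃; _,_)
open import Data.Sum using (_⊎_)
open import Relation.Binary.PropositionalEquality using (_≡_; _≢_)
open import Relation.Binary.Construct.Closure.ReflexiveTransitive using (Star)
open import Relation.Nullary using (¬_)

iter : {A : Set} → (A → A) → ℕ → A → A
iter f zero    x = x
iter f (suc k) x = f (iter f k x)

data Adj {m : ℕ} (a b c : Fin m → Fin m) : Fin m → Fin m → Set where
  adj₀ : ∀ f → Adj a b c f (a f)
  adj₁ : ∀ f → Adj a b c f (b f)
  adj₂ : ∀ f → Adj a b c f (c f)

data VAdj {m : ℕ} (b c : Fin m → Fin m) : Fin m → Fin m → Set where
  vadj₁ : ∀ f → VAdj b c f (b f)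
  vadj₂ : ∀ f → VAdj b c f (c f)

-- A (combinatorial) map: its finite set of flags together with the three
-- adjacency involutions r₀, r₁, r₂ (rᵢ f = the flag i-adjacent to f).
-- These are the standard axioms characterising flag systems of maps
-- (2-cell embeddings of connected multigraphs in closed surfaces).
record Map : Set where
  field
    n  : ℕ
    r₀ : Fin n → Fin n
    r₁ : Fin n → Fin n
    r₂ : Fin n → Fin n
    r₀-inv : ∀ f → r₀ (r₀ f) ≡ f
    r₁-inv : ∀ f → r₁ (r₁ f) ≡ f
    r₂-inv : ∀ f → r₂ (r₂ f) ≡ f
    r₀-fpf : ∀ f → r₀ f ≢ f
    r₁-fpf : ∀ f → r₁ f ≢ f
    r₂-fpf : ∀ f → r₂ f ≢ f
    r₀r₂-comm : ∀ f → r₀ (r₂ f) ≡ r₂ (r₀ f)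
    r₀r₂-fpf  : ∀ f → r₀ (r₂ f) ≢ f
    connected : ∀ f g → Star (Adj r₀ r₁ r₂) f g

open Map public

SameVertex : (M : Map) → Fin (n M) → Fin (n M) → Set
SameVertex M = Star (VAdj (r₁ M) (r₂ M))

-- "every face has k edges" at flag f: k is least positive with (r₀r₁)^k f = f
-- (the ⟨r₀,r₁⟩-orbit of f has 2k flags, i.e. the face has k edge-sides)
LeastPeriod : {A : Set} → (A → A) → A → ℕ → Set
LeastPeriod g x k = (1 ≤ k) × (iter g k x ≡ x) × (∀ j → 1 ≤ j → j < k → iter g j x ≢ x)

HasType : Map → ℕ → ℕ → Set
HasType M p q = ∀ f →
  LeastPeriod (λ x → r₀ M (r₁ M x)) f p × LeastPeriod (λ x → r₁ M (r₂ M x)) f q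

record Aut (M : Map) : Set where
  field
    φ   : Fin (n M) → Fin (n M)
    φ⁻¹ : Fin (n M) → Fin (n M)
    left  : ∀ f → φ⁻¹ (φ f) ≡ f
    right : ∀ f → φ (φ⁻¹ f) ≡ f
    comm₀ : ∀ f → φ (r₀ M f) ≡ r₀ M (φ f)
    comm₁ : ∀ f → φ (r₁ M f) ≡ r₁ M (φ f)
    comm₂ : ∀ f → φ (r₂ M f) ≡ r₂ M (φ f)
open Aut public

SameOrbit : (M : Map) → Fin (n M) → Fin (n M) → Set
SameOrbit M f g = Σ (Aut M) λ a → φ a f ≡ g

VertexTransitive : Map → Set
VertexTransitive M = ∀ f g → Σ (Aut M) λ a → SameVertex M (φ a f) g

Regular : Map → Set
Regular M = ∀ f g → SameOrbit M f g

Chiral : Map → Set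
Chiral M =
  (Σ (Fin (n M)) λ f₀ → Σ (Fin (n M)) λ f₁ →
      ¬ SameOrbit M f₀ f₁ × (∀ g → SameOrbit M f₀ g ⊎ SameOrbit M f₁ g))
  × (∀ f → ¬ SameOrbit M f (r₀ M f) × ¬ SameOrbit M f (r₁ M f) × ¬ SameOrbit M f (r₂ M f))

-- Fix a flag f. Since the map is vertex-transitive and trivalent, every automorphism orbit of
-- flags meets the six flags around the vertex of f, so the orbits are the classes of an
-- equivalence ∼ on these six flags that is compatible with the local action of r₁ and r₂, i.e.
-- the coset partition of a subgroup H of the dihedral group D₃ acting regularly on them.
-- Moving along r₀ induces an involution σ of the classes, and walking around a face becomes
-- iteration of σ ∘ r₁ on classes, which must return to its starting class after p steps.
-- If H contains no rotation, a finite enumeration of all possible σ exhibits a class to which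
-- this walk returns after no number of steps ≡ 1, 5, 7, 11 (mod 12), contradicting
-- p ≡ ±1 (mod 6). Hence H contains the rotations: either H = D₃ and the map is regular, or
-- H is the rotation subgroup, the two classes are the two parities, and the same enumeration
-- shows that σ must change parity, so the map is chiral.
module Submission where

open import Defs
open import Data.Nat using (ℕ; zero; suc; _+_; _*_; _^_; _%_; _/_; NonZero)
open import Data.Nat.Properties using (allUpTo?) renaming (_≟_ to _≟ℕ_)
open import Data.Nat.DivMod using (m≡m%n+[m/n]*n; m%n<n; m∣n⇒o%n%m≡o%m)
open import Data.Nat.Divisibility using (divides)
open import Data.Fin using (Fin; zero; suc; finToFun; funToFin)
open import Data.Fin.Properties using (any?; all?; _≟_; finToFun-funToFin)
open import Data.List using (List; []; _∷_; foldr; reverse)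
open import Data.List.Membership.Propositional using (_∈_)
open import Data.List.Membership.DecPropositional _≟ℕ_ using (_∈?_)
open import Data.List.Relation.Unary.All as All using (All)
open import Data.Product using (∃; _×_; _,_; proj₁; proj₂)
open import Data.Sum using (_⊎_; inj₁; inj₂; [_,_]′)
open import Data.Empty using (⊥; ⊥-elim)
open import Data.Unit using (⊤; tt)
open import Function using (_∘_; id; _⇔_; mk⇔; Equivalence)
open import Relation.Nullary using (¬_; Dec; yes; no)
open import Relation.Nullary.Decidable
  using (from-yes; map′; decidable-stable; ¬?; _×-dec_; _⊎-dec_; _→-dec_)
open import Relation.Binary.Core using (_Preserves_⟶_)
open import Level using (0ℓ)
open import Relation.Binary.Bundles using (Setoid)
open import Relation.Binary.Structures using (IsEquivalence)
open import Relation.Binary.Definitions using (Decidable)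
open import Relation.Binary.PropositionalEquality
  using (_≡_; _≢_; refl; sym; trans; cong; subst; subst₂; module ≡-Reasoning)
open import Relation.Binary.Construct.Closure.ReflexiveTransitive using (ε; _◅_)
import Relation.Binary.Reasoning.Setoid as SetoidReasoning

-- Iteration and residues mod 12

iter-+ : {A : Set} (g : A → A) (m k : ℕ) (x : A) → iter g (m + k) x ≡ iter g m (iter g k x)
iter-+ g zero    k x = refl
iter-+ g (suc m) k x = cong g (iter-+ g m k x)

iter-*-periodic : {A : Set} (g : A → A) {k : ℕ} {x : A} →
                  iter g k x ≡ x → ∀ q → iter g (q * k) x ≡ x
iter-*-periodic g         e zero    = refl
iter-*-periodic g {k} {x} e (suc q) = begin
  iter g (k + q * k) x        ≡⟨ iter-+ g k (q * k) x ⟩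
  iter g k (iter g (q * k) x) ≡⟨ cong (iter g k) (iter-*-periodic g e q) ⟩
  iter g k x                  ≡⟨ e ⟩
  x                           ∎
  where open ≡-Reasoning

iter-% : {A : Set} (g : A → A) (k : ℕ) .{{_ : NonZero k}} {x : A} →
         iter g k x ≡ x → ∀ m → iter g m x ≡ iter g (m % k) x
iter-% g k {x} e m = begin
  iter g m x                            ≡⟨ cong (λ t → iter g t x) (m≡m%n+[m/n]*n m k) ⟩
  iter g (m % k + m / k * k) x          ≡⟨ iter-+ g (m % k) (m / k * k) x ⟩
  iter g (m % k) (iter g (m / k * k) x) ≡⟨ cong (iter g (m % k)) (iter-*-periodic g e (m / k)) ⟩
  iter g (m % k) x                      ∎
  where open ≡-Reasoning

±1-mod6 : ℕ → Set
±1-mod6 m = m % 6 ≡ 1 ⊎ m % 6 ≡ 5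

units-mod12 : List ℕ
units-mod12 = 1 ∷ 5 ∷ 7 ∷ 11 ∷ []

±1-mod6⇒%12∈units : ∀ m → ±1-mod6 m → m % 12 ∈ units-mod12
±1-mod6⇒%12∈units m m±1 =
  from-yes (allUpTo? (λ r → (r % 6 ≟ℕ 1 ⊎-dec r % 6 ≟ℕ 5) →-dec r ∈? units-mod12) 12)
    (m%n<n m 12) (subst (λ r → r ≡ 1 ⊎ r ≡ 5) (sym (m∣n⇒o%n%m≡o%m 6 12 m (divides 2 refl))) m±1)

-- Automorphism orbits

module Orbits (M : Map) where

  Flag : Set
  Flag = Fin (n M)

  Aut-id : Aut M
  Aut-id = record { φ = id ; φ⁻¹ = id ; left = λ _ → refl ; right = λ _ → refl
                  ; comm₀ = λ _ → refl ; comm₁ = λ _ → refl ; comm₂ = λ _ → refl }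

  Aut-∘ : Aut M → Aut M → Aut M
  Aut-∘ a b = record
    { φ     = φ a ∘ φ b
    ; φ⁻¹   = φ⁻¹ b ∘ φ⁻¹ a
    ; left  = λ x → trans (cong (φ⁻¹ b) (left a (φ b x))) (left b x)
    ; right = λ x → trans (cong (φ a) (right b (φ⁻¹ a x))) (right a x)
    ; comm₀ = λ x → trans (cong (φ a) (comm₀ b x)) (comm₀ a (φ b x))
    ; comm₁ = λ x → trans (cong (φ a) (comm₁ b x)) (comm₁ a (φ b x))
    ; comm₂ = λ x → trans (cong (φ a) (comm₂ b x)) (comm₂ a (φ b x))
    }

  φ⁻¹-comm : (a : Aut M) {r : Flag → Flag} →
             (∀ x → φ a (r x) ≡ r (φ a x)) → ∀ x → φ⁻¹ a (r x) ≡ r (φ⁻¹ a x)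
  φ⁻¹-comm a {r} comm x = begin
    φ⁻¹ a (r x)               ≡⟨ cong (φ⁻¹ a ∘ r) (sym (right a x)) ⟩
    φ⁻¹ a (r (φ a (φ⁻¹ a x))) ≡⟨ cong (φ⁻¹ a) (sym (comm (φ⁻¹ a x))) ⟩
    φ⁻¹ a (φ a (r (φ⁻¹ a x))) ≡⟨ left a (r (φ⁻¹ a x)) ⟩
    r (φ⁻¹ a x)               ∎
    where open ≡-Reasoning

  Aut-inverse : Aut M → Aut M
  Aut-inverse a = record
    { φ = φ⁻¹ a ; φ⁻¹ = φ a ; left = right a ; right = left a
    ; comm₀ = φ⁻¹-comm a (comm₀ a) ; comm₁ = φ⁻¹-comm a (comm₁ a) ; comm₂ = φ⁻¹-comm a (comm₂ a)
    }

  SameOrbit-refl : ∀ {x} → SameOrbit M x x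
  SameOrbit-refl = Aut-id , refl

  SameOrbit-sym : ∀ {x y} → SameOrbit M x y → SameOrbit M y x
  SameOrbit-sym {x} (a , e) = Aut-inverse a , trans (cong (φ⁻¹ a) (sym e)) (left a x)

  SameOrbit-trans : ∀ {x y z} → SameOrbit M x y → SameOrbit M y z → SameOrbit M x z
  SameOrbit-trans (a , e) (b , e′) = Aut-∘ b a , trans (cong (φ b) e) e′

  SameOrbit-isEquivalence : IsEquivalence (SameOrbit M)
  SameOrbit-isEquivalence =
    record { refl = SameOrbit-refl ; sym = SameOrbit-sym ; trans = SameOrbit-trans }

  SameOrbit-setoid : Setoid 0ℓ 0ℓ
  SameOrbit-setoid = record { isEquivalence = SameOrbit-isEquivalence }

  module SameOrbit-Reasoning = SetoidReasoning SameOrbit-setoid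

  SameOrbit-cong : {r : Flag → Flag} → (∀ (a : Aut M) x → φ a (r x) ≡ r (φ a x)) →
                   ∀ {x y} → SameOrbit M x y → SameOrbit M (r x) (r y)
  SameOrbit-cong {r} comm {x} (a , e) = a , trans (comm a x) (cong r e)

  SameOrbit-adjacent : {r : Flag → Flag} → (∀ (a : Aut M) x → φ a (r x) ≡ r (φ a x)) →
                       ∀ {x y} → SameOrbit M x y → SameOrbit M y (r y) → SameOrbit M x (r x)
  SameOrbit-adjacent comm x∼y y∼ry =
    SameOrbit-trans x∼y (SameOrbit-trans y∼ry (SameOrbit-sym (SameOrbit-cong comm x∼y)))

  IsAutomorphismPair : (g h : Flag → Flag) → Set
  IsAutomorphismPair g h =
    (∀ z → h (g z) ≡ z) × (∀ z → g (h z) ≡ z) × (∀ z → g (r₀ M z) ≡ r₀ M (g z)) ×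
    (∀ z → g (r₁ M z) ≡ r₁ M (g z)) × (∀ z → g (r₂ M z) ≡ r₂ M (g z))

  isAutomorphismPair? : ∀ g h → Dec (IsAutomorphismPair g h)
  isAutomorphismPair? g h =
    all? (λ z → h (g z) ≟ z) ×-dec all? (λ z → g (h z) ≟ z) ×-dec
    all? (λ z → g (r₀ M z) ≟ r₀ M (g z)) ×-dec all? (λ z → g (r₁ M z) ≟ r₁ M (g z)) ×-dec
    all? (λ z → g (r₂ M z) ≟ r₂ M (g z))

  IsAutomorphismPair-≗ : ∀ {g g′ h h′} → (∀ z → g z ≡ g′ z) → (∀ z → h z ≡ h′ z) →
                         IsAutomorphismPair g h → IsAutomorphismPair g′ h′
  IsAutomorphismPair-≗ {g} {g′} {h} {h′} g≗g′ h≗h′ (l , r , c₀ , c₁ , c₂) =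
      (λ z → trans (sym (h≗h′ (g′ z))) (trans (cong h (sym (g≗g′ z))) (l z)))
    , (λ z → trans (sym (g≗g′ (h′ z))) (trans (cong g (sym (h≗h′ z))) (r z)))
    , commutes c₀ , commutes c₁ , commutes c₂
    where
    commutes : {s : Flag → Flag} → (∀ z → g (s z) ≡ s (g z)) → ∀ z → g′ (s z) ≡ s (g′ z)
    commutes {s} c z = trans (sym (g≗g′ (s z))) (trans (c z) (cong s (g≗g′ z)))

  -- Functions on the flags are enumerated by their codes in Fin (N ^ N), N the number of flags.
  CodedAutomorphism : Flag → Flag → Set
  CodedAutomorphism x y = ∃ λ (k : Fin (n M ^ n M)) → ∃ λ (l : Fin (n M ^ n M)) →
    IsAutomorphismPair (finToFun k) (finToFun l) × finToFun k x ≡ y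

  SameOrbit? : ∀ x y → Dec (SameOrbit M x y)
  SameOrbit? x y = map′ decode encode
    (any? λ k → any? λ l → isAutomorphismPair? (finToFun k) (finToFun l) ×-dec (finToFun k x ≟ y))
    where
    decode : CodedAutomorphism x y → SameOrbit M x y
    decode (k , l , (le , ri , c₀ , c₁ , c₂) , e) =
      record { φ = finToFun k ; φ⁻¹ = finToFun l ; left = le ; right = ri
             ; comm₀ = c₀ ; comm₁ = c₁ ; comm₂ = c₂ } , e
    encode : SameOrbit M x y → CodedAutomorphism x y
    encode (a , e) =
        funToFin (φ a) , funToFin (φ⁻¹ a)
      , IsAutomorphismPair-≗ (sym ∘ finToFun-funToFin (φ a)) (sym ∘ finToFun-funToFin (φ⁻¹ a))
          (left a , right a , comm₀ a , comm₁ a , comm₂ a)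
      , trans (finToFun-funToFin (φ a) x) e

-- Fin 6 models the six flags around a trivalent vertex in cyclic order, with ρ₁ and ρ₂
-- playing the roles of r₁ and r₂.

pattern q0 = zero
pattern q1 = suc zero
pattern q2 = suc (suc zero)
pattern q3 = suc (suc (suc zero))
pattern q4 = suc (suc (suc (suc zero)))
pattern q5 = suc (suc (suc (suc (suc zero))))

ρ₁ : Fin 6 → Fin 6
ρ₁ q0 = q1
ρ₁ q1 = q0
ρ₁ q2 = q3
ρ₁ q3 = q2
ρ₁ q4 = q5
ρ₁ q5 = q4

ρ₂ : Fin 6 → Fin 6
ρ₂ q0 = q5
ρ₂ q1 = q2
ρ₂ q2 = q1
ρ₂ q3 = q4
ρ₂ q4 = q3
ρ₂ q5 = q0

data Generator : Set where
  ρ₁ᵍ ρ₂ᵍ : Generator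

act : Generator → Fin 6 → Fin 6
act ρ₁ᵍ = ρ₁
act ρ₂ᵍ = ρ₂

actWord : List Generator → Fin 6 → Fin 6
actWord w i = foldr act i w

toOrigin : Fin 6 → List Generator
toOrigin q0 = []
toOrigin q1 = ρ₁ᵍ ∷ []
toOrigin q2 = ρ₁ᵍ ∷ ρ₂ᵍ ∷ []
toOrigin q3 = ρ₁ᵍ ∷ ρ₂ᵍ ∷ ρ₁ᵍ ∷ []
toOrigin q4 = ρ₂ᵍ ∷ ρ₁ᵍ ∷ []
toOrigin q5 = ρ₂ᵍ ∷ []

actWord-toOrigin : ∀ i → actWord (toOrigin i) i ≡ q0
actWord-toOrigin = from-yes (all? λ i → actWord (toOrigin i) i ≟ q0)

actWord-reverse-toOrigin : ∀ i → actWord (reverse (toOrigin i)) q0 ≡ i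
actWord-reverse-toOrigin = from-yes (all? λ i → actWord (reverse (toOrigin i)) q0 ≟ i)

actWord-reverse-toOrigin-inverse :
  ∀ i j → actWord (reverse (toOrigin i)) (actWord (toOrigin i) j) ≡ j
actWord-reverse-toOrigin-inverse =
  from-yes (all? λ i → all? λ j → actWord (reverse (toOrigin i)) (actWord (toOrigin i) j) ≟ j)

-- A labelling names each class of a ρ₁,ρ₂-invariant partition by its least element.

IsLabelling : (Fin 6 → Fin 6) → Set
IsLabelling c = (∀ i → c (c i) ≡ c i) ×
  (∀ i j → (c (actWord (toOrigin i) j) ≡ c q0 → c i ≡ c j) ×
           (c i ≡ c j → c (actWord (toOrigin i) j) ≡ c q0))

isLabelling? : ∀ c → Dec (IsLabelling c)
isLabelling? c = all? (λ i → c (c i) ≟ c i) ×-dec all? λ i → all? λ j →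
  ((c (actWord (toOrigin i) j) ≟ c q0) →-dec (c i ≟ c j)) ×-dec
  ((c i ≟ c j) →-dec (c (actWord (toOrigin i) j) ≟ c q0))

-- Labellings of the cosets of the subgroups of D₃ other than the trivial one and D₃ itself:
-- the reflection subgroups whose coset through q0 is {q0, qk}, and the rotation subgroup.
label₀₁ label₀₃ label₀₅ parity : Fin 6 → Fin 6
label₀₁ q0 = q0
label₀₁ q1 = q0
label₀₁ q2 = q2
label₀₁ q3 = q3
label₀₁ q4 = q3
label₀₁ q5 = q2
label₀₃ q0 = q0
label₀₃ q1 = q1
label₀₃ q2 = q1
label₀₃ q3 = q0
label₀₃ q4 = q4
label₀₃ q5 = q4
label₀₅ q0 = q0
label₀₅ q1 = q1
label₀₅ q2 = q2
label₀₅ q3 = q2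
label₀₅ q4 = q1
label₀₅ q5 = q0
parity q0 = q0
parity q1 = q1
parity q2 = q0
parity q3 = q1
parity q4 = q0
parity q5 = q1

isLabelling-id : IsLabelling id
isLabelling-id = from-yes (isLabelling? id)

isLabelling₀₁ : IsLabelling label₀₁
isLabelling₀₁ = from-yes (isLabelling? label₀₁)

isLabelling₀₃ : IsLabelling label₀₃
isLabelling₀₃ = from-yes (isLabelling? label₀₃)

isLabelling₀₅ : IsLabelling label₀₅
isLabelling₀₅ = from-yes (isLabelling? label₀₅)

isLabelling-parity : IsLabelling parity
isLabelling-parity = from-yes (isLabelling? parity)

parity-ρ₁ : ∀ i → parity (ρ₁ i) ≢ parity i
parity-ρ₁ = from-yes (all? λ i → ¬? (parity (ρ₁ i) ≟ parity i))

parity-ρ₂ : ∀ i → parity (ρ₂ i) ≢ parity i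
parity-ρ₂ = from-yes (all? λ i → ¬? (parity (ρ₂ i) ≟ parity i))

parity-dichotomy : ∀ i → parity q0 ≡ parity i ⊎ parity q1 ≡ parity i
parity-dichotomy = from-yes (all? λ i → (parity q0 ≟ parity i) ⊎-dec (parity q1 ≟ parity i))

-- Candidate actions of r₀ on the classes of a labelling c, as maps b with values in labels.
-- Commuting with ρ₂ forces b 2, b 4, b 5 from b 1, b 3, b 0.

extend : (c : Fin 6 → Fin 6) → Fin 6 → Fin 6 → Fin 6 → Fin 6 → Fin 6
extend c x y z q0 = x
extend c x y z q1 = y
extend c x y z q2 = c (ρ₂ y)
extend c x y z q3 = z
extend c x y z q4 = c (ρ₂ z)
extend c x y z q5 = c (ρ₂ x)

Admissible : (c b : Fin 6 → Fin 6) → Set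
Admissible c b = ∀ i →
  (b i ≡ b (c i)) × (b (b i) ≡ c i) × (b (ρ₂ i) ≡ c (ρ₂ (b i))) × (c (b i) ≡ b i)

admissible? : ∀ c b → Dec (Admissible c b)
admissible? c b = all? λ i →
  (b i ≟ b (c i)) ×-dec (b (b i) ≟ c i) ×-dec (b (ρ₂ i) ≟ c (ρ₂ (b i))) ×-dec (c (b i) ≟ b i)

Obstructed : (c b : Fin 6 → Fin 6) → Set
Obstructed c b =
  ∃ λ i → iter (b ∘ ρ₁) 12 i ≡ i × All (λ r → c (iter (b ∘ ρ₁) r i) ≢ c i) units-mod12

obstructed? : ∀ c b → Dec (Obstructed c b)
obstructed? c b = any? λ i →
  (iter (b ∘ ρ₁) 12 i ≟ i) ×-dec All.all? (λ r → ¬? (c (iter (b ∘ ρ₁) r i) ≟ c i)) units-mod12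

AllObstructed : (c : Fin 6 → Fin 6) → ((Fin 6 → Fin 6) → Set) → Set
AllObstructed c Q = ∀ x y z → let b = extend c x y z in Admissible c b → Q b → Obstructed c b

allObstructed? : ∀ c {Q} → (∀ b → Dec (Q b)) → Dec (AllObstructed c Q)
allObstructed? c Q? = all? λ x → all? λ y → all? λ z →
  admissible? c (extend c x y z) →-dec Q? (extend c x y z) →-dec obstructed? c (extend c x y z)

Unconstrained : (Fin 6 → Fin 6) → Set
Unconstrained _ = ⊤

FixesALabel : (c b : Fin 6 → Fin 6) → Set
FixesALabel c b = ∃ λ i → b i ≡ c i

allObstructed-id : AllObstructed id Unconstrained
allObstructed-id = from-yes (allObstructed? id λ _ → yes tt)

allObstructed₀₁ : AllObstructed label₀₁ Unconstrained
allObstructed₀₁ = from-yes (allObstructed? label₀₁ λ _ → yes tt)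

allObstructed₀₃ : AllObstructed label₀₃ Unconstrained
allObstructed₀₃ = from-yes (allObstructed? label₀₃ λ _ → yes tt)

allObstructed₀₅ : AllObstructed label₀₅ Unconstrained
allObstructed₀₅ = from-yes (allObstructed? label₀₅ λ _ → yes tt)

allObstructed-parity : AllObstructed parity (FixesALabel parity)
allObstructed-parity = from-yes (allObstructed? parity λ b → any? λ i → b i ≟ parity i)

-- Classification of the orbits at a vertex

-- i ∼ j: the i-th and j-th flags around a fixed vertex lie in one orbit; σ i: a flag around
-- the vertex lying in the orbit of the r₀-neighbour of the i-th one.
record OrbitsAtVertex (p : ℕ) : Set₁ where
  field
    _∼_           : Fin 6 → Fin 6 → Set
    isEquivalence : IsEquivalence _∼_
    _∼?_          : Decidable _∼_
    ρ₁-cong       : ρ₁ Preserves _∼_ ⟶ _∼_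
    ρ₂-cong       : ρ₂ Preserves _∼_ ⟶ _∼_
    σ             : Fin 6 → Fin 6
    σ-cong        : σ Preserves _∼_ ⟶ _∼_
    σ-involutive  : ∀ i → σ (σ i) ∼ i
    σ-ρ₂          : ∀ i → σ (ρ₂ i) ∼ ρ₂ (σ i)
    face-period   : ∀ i → iter (σ ∘ ρ₁) p i ∼ i

module Classification {p : ℕ} (p±1 : ±1-mod6 p) (O : OrbitsAtVertex p) where
  open OrbitsAtVertex O
  open IsEquivalence isEquivalence renaming (refl to ∼-refl; sym to ∼-sym; trans to ∼-trans)

  actWord-cong : ∀ w → actWord w Preserves _∼_ ⟶ _∼_
  actWord-cong []         e = e
  actWord-cong (ρ₁ᵍ ∷ w) e = ρ₁-cong (actWord-cong w e)
  actWord-cong (ρ₂ᵍ ∷ w) e = ρ₂-cong (actWord-cong w e)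

  record KernelAt (c : Fin 6 → Fin 6) (k : Fin 6) : Set where
    field
      sound    : q0 ∼ k → c k ≡ c q0
      complete : c k ≡ c q0 → q0 ∼ k

  Kernel : (Fin 6 → Fin 6) → Set
  Kernel c = ∀ k → KernelAt c k

  member : ∀ {c k} → c k ≡ c q0 → q0 ∼ k → KernelAt c k
  member e r = record { sound = λ _ → e ; complete = λ _ → r }

  nonmember : ∀ {c k} → c k ≢ c q0 → ¬ q0 ∼ k → KernelAt c k
  nonmember ne nr = record { sound = ⊥-elim ∘ nr ; complete = ⊥-elim ∘ ne }

  module Labelled {c : Fin 6 → Fin 6} (lab : IsLabelling c) (ker : Kernel c) where
    idempotent : ∀ i → c (c i) ≡ c i
    idempotent = proj₁ lab

    invariant : ∀ i j → (c (actWord (toOrigin i) j) ≡ c q0 → c i ≡ c j) ×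
                        (c i ≡ c j → c (actWord (toOrigin i) j) ≡ c q0)
    invariant = proj₂ lab

    label-sound : ∀ {i j} → i ∼ j → c i ≡ c j
    label-sound {i} {j} i∼j = proj₁ (invariant i j) (KernelAt.sound (ker (actWord (toOrigin i) j))
      (subst (_∼ actWord (toOrigin i) j) (actWord-toOrigin i) (actWord-cong (toOrigin i) i∼j)))

    label-complete : ∀ {i j} → c i ≡ c j → i ∼ j
    label-complete {i} {j} ci≡cj =
      subst₂ _∼_ (actWord-reverse-toOrigin i) (actWord-reverse-toOrigin-inverse i j)
        (actWord-cong (reverse (toOrigin i))
          (KernelAt.complete (ker _) (proj₂ (invariant i j) ci≡cj)))

    ∼-label : ∀ i → i ∼ c i
    ∼-label i = label-complete (sym (idempotent i))

    cσ : Fin 6 → Fin 6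
    cσ = c ∘ σ

    b : Fin 6 → Fin 6
    b = extend c (cσ q0) (cσ q1) (cσ q3)

    cσ-ρ₂ : ∀ i → cσ (ρ₂ i) ≡ c (ρ₂ (cσ i))
    cσ-ρ₂ i = label-sound (∼-trans (σ-ρ₂ i) (ρ₂-cong (∼-label (σ i))))

    cσ≗b : ∀ i → cσ i ≡ b i
    cσ≗b q0 = refl
    cσ≗b q1 = refl
    cσ≗b q2 = cσ-ρ₂ q1
    cσ≗b q3 = refl
    cσ≗b q4 = cσ-ρ₂ q3
    cσ≗b q5 = cσ-ρ₂ q0

    admissible : Admissible c b
    admissible i =
        trans (sym (cσ≗b i)) (trans (label-sound (σ-cong (∼-label i))) (cσ≗b (c i)))
      , trans (cong b (sym (cσ≗b i))) (trans (sym (cσ≗b (cσ i)))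
          (label-sound (∼-trans (σ-cong (∼-sym (∼-label (σ i)))) (σ-involutive i))))
      , trans (sym (cσ≗b (ρ₂ i))) (trans (cσ-ρ₂ i) (cong (c ∘ ρ₂) (cσ≗b i)))
      , trans (cong c (sym (cσ≗b i))) (trans (idempotent (σ i)) (cσ≗b i))

    b∼σ : ∀ i → b i ∼ σ i
    b∼σ i = subst (_∼ σ i) (cσ≗b i) (∼-sym (∼-label (σ i)))

    iter-bρ₁∼iter-σρ₁ : ∀ k i → iter (b ∘ ρ₁) k i ∼ iter (σ ∘ ρ₁) k i
    iter-bρ₁∼iter-σρ₁ zero    i = ∼-refl
    iter-bρ₁∼iter-σρ₁ (suc k) i = ∼-trans (b∼σ _) (σ-cong (ρ₁-cong (iter-bρ₁∼iter-σρ₁ k i)))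

    -- The walk from i returns to the label of i after p steps, and p % 12 is a unit mod 12.
    unobstructed : ¬ Obstructed c b
    unobstructed (i , period-12 , escapes) = All.lookup escapes (±1-mod6⇒%12∈units p p±1) (begin
      c (iter (b ∘ ρ₁) (p % 12) i) ≡⟨ cong c (iter-% (b ∘ ρ₁) 12 period-12 p) ⟨
      c (iter (b ∘ ρ₁) p i)        ≡⟨ label-sound (∼-trans (iter-bρ₁∼iter-σρ₁ p i) (face-period i)) ⟩
      c i                          ∎)
      where open ≡-Reasoning

    refute : ∀ Q → AllObstructed c Q → Q b → ⊥
    refute _ all q = unobstructed (all _ _ _ admissible q)

    σ-fixed⇒b-fixed : ∀ {i} → σ i ∼ i → b i ≡ c i
    σ-fixed⇒b-fixed {i} σi∼i = trans (sym (cσ≗b i)) (label-sound σi∼i)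

  ¬q0∼q2⇒¬q0∼q4 : ¬ q0 ∼ q2 → ¬ q0 ∼ q4
  ¬q0∼q2⇒¬q0∼q4 ≁₂ = ≁₂ ∘ ∼-sym ∘ ρ₂-cong ∘ ρ₁-cong

  q0∼q2⇒q0∼q4 : q0 ∼ q2 → q0 ∼ q4
  q0∼q2⇒q0∼q4 ∼₂ = ∼-trans ∼₂ (ρ₂-cong (ρ₁-cong ∼₂))

  kernel-id : ¬ q0 ∼ q1 → ¬ q0 ∼ q2 → ¬ q0 ∼ q3 → ¬ q0 ∼ q5 → Kernel id
  kernel-id ≁₁ ≁₂ ≁₃ ≁₅ q0 = member refl ∼-refl
  kernel-id ≁₁ ≁₂ ≁₃ ≁₅ q1 = nonmember (λ ()) ≁₁
  kernel-id ≁₁ ≁₂ ≁₃ ≁₅ q2 = nonmember (λ ()) ≁₂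
  kernel-id ≁₁ ≁₂ ≁₃ ≁₅ q3 = nonmember (λ ()) ≁₃
  kernel-id ≁₁ ≁₂ ≁₃ ≁₅ q4 = nonmember (λ ()) (¬q0∼q2⇒¬q0∼q4 ≁₂)
  kernel-id ≁₁ ≁₂ ≁₃ ≁₅ q5 = nonmember (λ ()) ≁₅

  kernel₀₁ : q0 ∼ q1 → ¬ q0 ∼ q2 → Kernel label₀₁
  kernel₀₁ ∼₁ ≁₂ q0 = member refl ∼-refl
  kernel₀₁ ∼₁ ≁₂ q1 = member refl ∼₁
  kernel₀₁ ∼₁ ≁₂ q2 = nonmember (λ ()) ≁₂
  kernel₀₁ ∼₁ ≁₂ q3 = nonmember (λ ()) (≁₂ ∘ ρ₁-cong ∘ ∼-trans (∼-sym ∼₁))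
  kernel₀₁ ∼₁ ≁₂ q4 = nonmember (λ ()) (¬q0∼q2⇒¬q0∼q4 ≁₂)
  kernel₀₁ ∼₁ ≁₂ q5 = nonmember (λ ()) (≁₂ ∘ ∼-sym ∘ ρ₂-cong ∘ ∼-trans (∼-sym ∼₁))

  kernel₀₃ : ¬ q0 ∼ q1 → ¬ q0 ∼ q2 → q0 ∼ q3 → Kernel label₀₃
  kernel₀₃ ≁₁ ≁₂ ∼₃ q0 = member refl ∼-refl
  kernel₀₃ ≁₁ ≁₂ ∼₃ q1 = nonmember (λ ()) ≁₁
  kernel₀₃ ≁₁ ≁₂ ∼₃ q2 = nonmember (λ ()) ≁₂
  kernel₀₃ ≁₁ ≁₂ ∼₃ q3 = member refl ∼₃
  kernel₀₃ ≁₁ ≁₂ ∼₃ q4 = nonmember (λ ()) (¬q0∼q2⇒¬q0∼q4 ≁₂)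
  kernel₀₃ ≁₁ ≁₂ ∼₃ q5 =
    nonmember (λ ()) (¬q0∼q2⇒¬q0∼q4 ≁₂ ∘ ∼-sym ∘ ρ₂-cong ∘ ∼-trans (∼-sym ∼₃))

  kernel₀₅ : ¬ q0 ∼ q1 → ¬ q0 ∼ q2 → ¬ q0 ∼ q3 → q0 ∼ q5 → Kernel label₀₅
  kernel₀₅ ≁₁ ≁₂ ≁₃ ∼₅ q0 = member refl ∼-refl
  kernel₀₅ ≁₁ ≁₂ ≁₃ ∼₅ q1 = nonmember (λ ()) ≁₁
  kernel₀₅ ≁₁ ≁₂ ≁₃ ∼₅ q2 = nonmember (λ ()) ≁₂
  kernel₀₅ ≁₁ ≁₂ ≁₃ ∼₅ q3 = nonmember (λ ()) ≁₃
  kernel₀₅ ≁₁ ≁₂ ≁₃ ∼₅ q4 = nonmember (λ ()) (¬q0∼q2⇒¬q0∼q4 ≁₂)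
  kernel₀₅ ≁₁ ≁₂ ≁₃ ∼₅ q5 = member refl ∼₅

  kernel-parity : ¬ q0 ∼ q1 → q0 ∼ q2 → Kernel parity
  kernel-parity ≁₁ ∼₂ q0 = member refl ∼-refl
  kernel-parity ≁₁ ∼₂ q1 = nonmember (λ ()) ≁₁
  kernel-parity ≁₁ ∼₂ q2 = member refl ∼₂
  kernel-parity ≁₁ ∼₂ q3 = nonmember (λ ()) (≁₁ ∘ ∼-trans ∼₂ ∘ ∼-sym ∘ ρ₁-cong)
  kernel-parity ≁₁ ∼₂ q4 = member refl (q0∼q2⇒q0∼q4 ∼₂)
  kernel-parity ≁₁ ∼₂ q5 = nonmember (λ ()) (≁₁ ∘ ∼-trans (q0∼q2⇒q0∼q4 ∼₂) ∘ ∼-sym ∘ ρ₁-cong)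

  q0∼q2 : q0 ∼ q2
  q0∼q2 = decidable-stable (q0 ∼? q2) no-rotation-impossible
    where
    no-rotation-impossible : ¬ q0 ∼ q2 → ⊥
    no-rotation-impossible ≁₂ with q0 ∼? q1 | q0 ∼? q3 | q0 ∼? q5
    ... | yes ∼₁ | _      | _      =
      Labelled.refute isLabelling₀₁ (kernel₀₁ ∼₁ ≁₂) Unconstrained allObstructed₀₁ tt
    ... | no ≁₁ | yes ∼₃ | _      =
      Labelled.refute isLabelling₀₃ (kernel₀₃ ≁₁ ≁₂ ∼₃) Unconstrained allObstructed₀₃ tt
    ... | no ≁₁ | no ≁₃ | yes ∼₅ =
      Labelled.refute isLabelling₀₅ (kernel₀₅ ≁₁ ≁₂ ≁₃ ∼₅) Unconstrained allObstructed₀₅ tt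
    ... | no ≁₁ | no ≁₃ | no ≁₅ =
      Labelled.refute isLabelling-id (kernel-id ≁₁ ≁₂ ≁₃ ≁₅) Unconstrained allObstructed-id tt

  all-related : q0 ∼ q1 → ∀ i j → i ∼ j
  all-related ∼₁ i j = ∼-trans (∼-sym (from-q0 i)) (from-q0 j)
    where
    from-q0 : ∀ k → q0 ∼ k
    from-q0 q0 = ∼-refl
    from-q0 q1 = ∼₁
    from-q0 q2 = q0∼q2
    from-q0 q3 = ∼-trans ∼₁ (ρ₁-cong q0∼q2)
    from-q0 q4 = q0∼q2⇒q0∼q4 q0∼q2
    from-q0 q5 = ∼-trans q0∼q2 (∼-sym (ρ₂-cong ∼₁))

  ParityClasses : Set
  ParityClasses = (∀ i j → i ∼ j ⇔ parity i ≡ parity j) × (∀ i → ¬ σ i ∼ i)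

  parity-classes : ¬ q0 ∼ q1 → ParityClasses
  parity-classes ≁₁ =
      (λ i j → mk⇔ label-sound label-complete)
    , (λ i σi∼i → refute (FixesALabel parity) allObstructed-parity (i , σ-fixed⇒b-fixed σi∼i))
    where open Labelled isLabelling-parity (kernel-parity ≁₁ q0∼q2)

  classify : (∀ i j → i ∼ j) ⊎ ParityClasses
  classify with q0 ∼? q1
  ... | yes ∼₁ = inj₁ (all-related ∼₁)
  ... | no ≁₁ = inj₂ (parity-classes ≁₁)

-- Orbits at a vertex of a trivalent vertex-transitive map

module AtVertex {p : ℕ} (M : Map) (type : HasType M p 3) (vt : VertexTransitive M)
                (f : Fin (n M)) where
  open Orbits M

  actᴹ : Generator → Flag → Flag
  actᴹ ρ₁ᵍ = r₁ M
  actᴹ ρ₂ᵍ = r₂ M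

  path : Fin 6 → List Generator
  path q0 = []
  path q1 = ρ₁ᵍ ∷ []
  path q2 = ρ₂ᵍ ∷ ρ₁ᵍ ∷ []
  path q3 = ρ₁ᵍ ∷ ρ₂ᵍ ∷ ρ₁ᵍ ∷ []
  path q4 = ρ₂ᵍ ∷ ρ₁ᵍ ∷ ρ₂ᵍ ∷ ρ₁ᵍ ∷ []
  path q5 = ρ₂ᵍ ∷ []

  around : Fin 6 → Flag → Flag
  around j x = foldr actᴹ x (path j)

  face-step : Flag → Flag
  face-step x = r₀ M (r₁ M x)

  face-length : ∀ x → iter face-step p x ≡ x
  face-length x = proj₁ (proj₂ (proj₁ (type x)))

  degree-3 : ∀ x → r₁ M (r₂ M (r₁ M (r₂ M (r₁ M (r₂ M x))))) ≡ x
  degree-3 x = proj₁ (proj₂ (proj₂ (type x)))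

  r₁-around₄ : ∀ x → r₁ M (around q4 x) ≡ around q5 x
  r₁-around₄ x = trans (cong (r₁ M ∘ around q4) (sym (r₂-inv M x))) (degree-3 (r₂ M x))

  r₁-around : ∀ j x → r₁ M (around j x) ≡ around (ρ₁ j) x
  r₁-around q0 x = refl
  r₁-around q1 x = r₁-inv M x
  r₁-around q2 x = refl
  r₁-around q3 x = r₁-inv M _
  r₁-around q4 x = r₁-around₄ x
  r₁-around q5 x = trans (cong (r₁ M) (sym (r₁-around₄ x))) (r₁-inv M _)

  r₂-around : ∀ j x → r₂ M (around j x) ≡ around (ρ₂ j) x
  r₂-around q0 x = refl
  r₂-around q1 x = refl
  r₂-around q2 x = r₂-inv M _
  r₂-around q3 x = refl
  r₂-around q4 x = r₂-inv M _
  r₂-around q5 x = r₂-inv M x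

  φ-foldr-actᴹ : (a : Aut M) → ∀ w x → φ a (foldr actᴹ x w) ≡ foldr actᴹ (φ a x) w
  φ-foldr-actᴹ a []        x = refl
  φ-foldr-actᴹ a (ρ₁ᵍ ∷ w) x = trans (comm₁ a _) (cong (r₁ M) (φ-foldr-actᴹ a w x))
  φ-foldr-actᴹ a (ρ₂ᵍ ∷ w) x = trans (comm₂ a _) (cong (r₂ M) (φ-foldr-actᴹ a w x))

  φ-around : (a : Aut M) → ∀ j x → φ a (around j x) ≡ around j (φ a x)
  φ-around a j = φ-foldr-actᴹ a (path j)

  around-closed : ∀ {x} j {z y} → z ≡ around j x → SameVertex M z y → ∃ λ k → y ≡ around k x
  around-closed j z≡ ε                = j , z≡
  around-closed j z≡ (vadj₁ _ ◅ steps) =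
    around-closed (ρ₁ j) (trans (cong (r₁ M) z≡) (r₁-around j _)) steps
  around-closed j z≡ (vadj₂ _ ◅ steps) =
    around-closed (ρ₂ j) (trans (cong (r₂ M) z≡) (r₂-around j _)) steps

  representative : ∀ g → ∃ λ j → SameOrbit M (around j f) g
  representative g with vt f g
  ... | a , steps with around-closed q0 refl steps
  ... | k , g≡ = k , a , trans (φ-around a k f) (sym g≡)

  _∼_ : Fin 6 → Fin 6 → Set
  i ∼ j = SameOrbit M (around i f) (around j f)

  σ : Fin 6 → Fin 6
  σ i = proj₁ (representative (r₀ M (around i f)))

  σ-represents : ∀ i → SameOrbit M (around (σ i) f) (r₀ M (around i f))
  σ-represents i = proj₂ (representative (r₀ M (around i f)))

  ρ₁-cong : ρ₁ Preserves _∼_ ⟶ _∼_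
  ρ₁-cong {i} {j} = subst₂ (SameOrbit M) (r₁-around i f) (r₁-around j f) ∘ SameOrbit-cong comm₁

  ρ₂-cong : ρ₂ Preserves _∼_ ⟶ _∼_
  ρ₂-cong {i} {j} = subst₂ (SameOrbit M) (r₂-around i f) (r₂-around j f) ∘ SameOrbit-cong comm₂

  σ-cong : σ Preserves _∼_ ⟶ _∼_
  σ-cong {i} {j} i∼j = begin
    around (σ i) f    ≈⟨ σ-represents i ⟩
    r₀ M (around i f) ≈⟨ SameOrbit-cong comm₀ i∼j ⟩
    r₀ M (around j f) ≈⟨ σ-represents j ⟨
    around (σ j) f    ∎
    where open SameOrbit-Reasoning

  σ-involutive : ∀ i → σ (σ i) ∼ i
  σ-involutive i = begin
    around (σ (σ i)) f       ≈⟨ σ-represents (σ i) ⟩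
    r₀ M (around (σ i) f)    ≈⟨ SameOrbit-cong comm₀ (σ-represents i) ⟩
    r₀ M (r₀ M (around i f)) ≡⟨ r₀-inv M (around i f) ⟩
    around i f               ∎
    where open SameOrbit-Reasoning

  σ-ρ₂ : ∀ i → σ (ρ₂ i) ∼ ρ₂ (σ i)
  σ-ρ₂ i = begin
    around (σ (ρ₂ i)) f      ≈⟨ σ-represents (ρ₂ i) ⟩
    r₀ M (around (ρ₂ i) f)   ≡⟨ cong (r₀ M) (r₂-around i f) ⟨
    r₀ M (r₂ M (around i f)) ≡⟨ r₀r₂-comm M (around i f) ⟩
    r₂ M (r₀ M (around i f)) ≈⟨ SameOrbit-cong comm₂ (σ-represents i) ⟨
    r₂ M (around (σ i) f)    ≡⟨ r₂-around (σ i) f ⟩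
    around (ρ₂ (σ i)) f      ∎
    where open SameOrbit-Reasoning

  around-iter-σρ₁ : ∀ k i →
    SameOrbit M (around (iter (σ ∘ ρ₁) k i) f) (iter face-step k (around i f))
  around-iter-σρ₁ zero    i = SameOrbit-refl
  around-iter-σρ₁ (suc k) i = begin
    around (σ (ρ₁ m)) f    ≈⟨ σ-represents (ρ₁ m) ⟩
    r₀ M (around (ρ₁ m) f) ≡⟨ cong (r₀ M) (r₁-around m f) ⟨
    face-step (around m f) ≈⟨ SameOrbit-cong comm₀ (SameOrbit-cong comm₁ (around-iter-σρ₁ k i)) ⟩
    face-step (iter face-step k (around i f)) ∎
    where
    m = iter (σ ∘ ρ₁) k i
    open SameOrbit-Reasoning

  face-period : ∀ i → iter (σ ∘ ρ₁) p i ∼ i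
  face-period i = subst (SameOrbit M _) (face-length (around i f)) (around-iter-σρ₁ p i)

  orbitsAtVertex : OrbitsAtVertex p
  orbitsAtVertex = record
    { _∼_           = _∼_
    ; isEquivalence = record { refl = SameOrbit-refl ; sym = SameOrbit-sym
                             ; trans = SameOrbit-trans }
    ; _∼?_          = λ i j → SameOrbit? (around i f) (around j f)
    ; ρ₁-cong       = λ {i} {j} → ρ₁-cong {i} {j}
    ; ρ₂-cong       = λ {i} {j} → ρ₂-cong {i} {j}
    ; σ             = σ
    ; σ-cong        = λ {i} {j} → σ-cong {i} {j}
    ; σ-involutive  = σ-involutive
    ; σ-ρ₂          = σ-ρ₂
    ; face-period   = face-period
    }

  regular : (∀ i j → i ∼ j) → Regular M
  regular all g h = SameOrbit-trans (SameOrbit-sym (from-f g)) (from-f h)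
    where
    from-f : ∀ g → SameOrbit M f g
    from-f g = SameOrbit-trans (all q0 (proj₁ (representative g))) (proj₂ (representative g))

  chiral : (∀ i j → i ∼ j ⇔ parity i ≡ parity j) → (∀ i → ¬ σ i ∼ i) → Chiral M
  chiral classes σ-moves =
    (f , r₁ M f , (λ ()) ∘ same-parity q0 q1 , two-orbits) , λ g → apart₀ g , apart₁ g , apart₂ g
    where
    same-parity : ∀ i j → i ∼ j → parity i ≡ parity j
    same-parity i j = Equivalence.to (classes i j)

    two-orbits : ∀ g → SameOrbit M f g ⊎ SameOrbit M (r₁ M f) g
    two-orbits g with representative g
    ... | j , o with parity-dichotomy j
    ... | inj₁ e = inj₁ (SameOrbit-trans (Equivalence.from (classes q0 j) e) o)
    ... | inj₂ e = inj₂ (SameOrbit-trans (Equivalence.from (classes q1 j) e) o)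

    apart₀ : ∀ g → ¬ SameOrbit M g (r₀ M g)
    apart₀ g g∼r₀g with representative g
    ... | j , o = σ-moves j (SameOrbit-sym
      (SameOrbit-trans (SameOrbit-adjacent comm₀ o g∼r₀g) (SameOrbit-sym (σ-represents j))))

    apart₁ : ∀ g → ¬ SameOrbit M g (r₁ M g)
    apart₁ g g∼r₁g with representative g
    ... | j , o = parity-ρ₁ j (sym (same-parity j (ρ₁ j) (subst (SameOrbit M _) (r₁-around j f)
      (SameOrbit-adjacent comm₁ o g∼r₁g))))

    apart₂ : ∀ g → ¬ SameOrbit M g (r₂ M g)
    apart₂ g g∼r₂g with representative g
    ... | j , o = parity-ρ₂ j (sym (same-parity j (ρ₂ j) (subst (SameOrbit M _) (r₂-around j f)
      (SameOrbit-adjacent comm₂ o g∼r₂g))))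

mainTheorem3 : (p : ℕ) → (p % 6 ≡ 1 ⊎ p % 6 ≡ 5) →
    (M : Map) → HasType M p 3 → VertexTransitive M → Regular M ⊎ Chiral M
mainTheorem3 p p±1 M type vt with any? (λ (_ : Fin (n M)) → yes tt)
... | no flagless  = inj₁ λ g _ → ⊥-elim (flagless (g , tt))
... | yes (f , _) =
  [ inj₁ ∘ regular , (λ (classes , σ-moves) → inj₂ (chiral classes σ-moves)) ]′
    (Classification.classify p±1 orbitsAtVertex)
  where open AtVertex M type vt f
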